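{- Let $a,b\in\mathbb Z$ and let $m$ be a positive integer with $m\in\mathcal F=\{5^k, 2\cdot 5^k, 4\cdot 5^k, 3^j5^k, 6\cdot 5^k, 7\cdot 5^k, 14\cdot 5^k : k\ge 0, j\ge 1\}$, $5\mid m$, and $\gcd(m, b^2-ab-a^2)=1$. Let $w_0=a$, $w_1=b$, $w_n=w_{n-1}+w_{n-2}$. If the sequence $(w_n)$ modulo $m$ is residue complete, then the sequence $(w_n)$ modulo $5m$ is residue complete.
   Context: For fixed integers $a,b$, $w_n=w_n(a,b)$ is defined by $w_0=a$, $w_1=b$, $w_n=w_{n-1}+w_{n-2}$; modulo $m$ it is periodic, and a period is denoted $w(a,b,m)$ (a Fibonacci cycle modulo $m$). It is residue complete if every $x\in\mathbb Z_m$ occurs in it. -}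

module Defs where

open import Data.Nat as ℕ using (ℕ; zero; suc; _^_; _≥_)
open import Data.Integer as ℤ using (ℤ; _+_; _-_; _*_)
open import Data.Integer.Divisibility using (_∣_)
open import Data.Product using (Σ; ∃; ∃-syntax; _×_)
open import Data.Sum using (_⊎_)
open import Relation.Binary.PropositionalEquality using (_≡_)

w : ℤ → ℤ → ℕ → ℤ
w a b zero = a
w a b (suc zero) = b
w a b (suc (suc n)) = w a b (suc n) + w a b n

ResidueComplete : ℤ → ℤ → ℕ → Set
ResidueComplete a b m = ∀ (x : ℤ) → ∃[ n ] (ℤ.+ m ∣ (w a b n - x))

InF : ℕ → Set
InF m = ∃[ k ]
  ( m ≡ 5 ^ k
  ⊎ m ≡ 2 ℕ.* 5 ^ k
  ⊎ m ≡ 4 ℕ.* 5 ^ k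
  ⊎ (∃[ j ] (j ≥ 1 × m ≡ 3 ^ j ℕ.* 5 ^ k))
  ⊎ m ≡ 6 ℕ.* 5 ^ k
  ⊎ m ≡ 7 ℕ.* 5 ^ k
  ⊎ m ≡ 14 ℕ.* 5 ^ k )

module Submission where

open import Defs
open import Data.Nat as ℕ using (ℕ; _^_)
open import Data.Integer as ℤ using (ℤ; _-_; _*_)
open import Data.Integer.GCD using (gcd)
open import Data.Nat.Divisibility using (_∣_)
open import Relation.Binary.PropositionalEquality using (_≡_)

open import Data.Nat using (zero; suc; _<_; s≤s)
open import Data.Integer using (+_; _+_; _%ℕ_; _/ℕ_)
open import Data.Integer.DivMod using (a≡a%ℕn+[a/ℕn]*n; n%ℕd<d)
open import Data.Integer.GCD using (gcd-greatest)
import Data.Nat.Properties as ℕ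
import Data.Integer.Properties as ℤ
import Data.Nat.Divisibility as ℕ∣
import Data.Integer.Divisibility as ℤ∣ᵤ
import Data.Integer.Divisibility.Signed as ℤ∣
open ℤ∣ using (divides) renaming (_∣_ to _∣ℤ_; _∣?_ to _∣ℤ?_)
open import Data.Nat.Primality using (Prime; euclidsLemma; prime?)
open import Data.Maybe using (Maybe; just; nothing; from-just)
open import Data.Product using (Σ; ∃; _×_; _,_; proj₁; proj₂)
open import Data.Sum using (_⊎_; inj₁; inj₂; [_,_]′)
open import Data.Empty using (⊥-elim)
open import Function using (_∘_)
open import Relation.Nullary using (¬_; Dec; yes; no)
open import Relation.Nullary.Decidable using (False; toWitnessFalse; from-yes; ¬?; _×-dec_)
open import Relation.Binary.PropositionalEquality
  using (_≢_; refl; sym; trans; cong; cong₂; subst; module ≡-Reasoning)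
open import Data.Integer.Tactic.RingSolver using (solve-∀)
import Data.Nat.Tactic.RingSolver as ℕ-Ring
open import Data.Integer.Solver using (module +-*-Solver)
open +-*-Solver using (Polynomial; _:+_; _:*_; con; _:=_; solve)

-- Work in ℤ[φ], φ² = φ + 1, where w_{P+n} = y·wₙ + x·wₙ₊₁ for φᴾ = y + xφ.
-- Call P an exact period for m if φᴾ = 1 + m·X with X exactly divisible by √5, i.e.
-- X ≡ β(φ − 3) (mod 5) with 5 ∤ β.  Then w_{P+n} = wₙ + m·uₙ with uₙ = αwₙ + βwₙ₊₁, and
-- when 5 ∣ m iterating gives  w_{kP+n} ≡ wₙ + k·m·uₙ (mod 5m).  Since
-- b² − ab − a² ≡ (b − 3a)² (mod 5) is prime to 5, no uₙ is divisible by 5; so if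
-- wₙ − x = q·m, a suitable k makes 5 ∣ q + k·uₙ, whence w_{kP+n} ≡ x (mod 5m).

-- x ≈ y mod n  means  n ∣ x - y.  A record, so that x, y and n are inferable.
infix 4 _≈_mod_
record _≈_mod_ (x y n : ℤ) : Set where
  constructor ≈-by
  field difference : n ∣ℤ x - y
open _≈_mod_

≡⇒≈ : ∀ {x y n} → x ≡ y → x ≈ y mod n
≡⇒≈ {x} refl = ≈-by (divides (+ 0) (x-x≡0*0 x))
  where
  x-x≡0*0 : ∀ x → x - x ≡ + 0 * + 0
  x-x≡0*0 = solve-∀

≈-sym : ∀ {x y n} → x ≈ y mod n → y ≈ x mod n
≈-sym {x} {y} (≈-by n∣x-y) = ≈-by (subst (_ ∣ℤ_) (negate x y) (ℤ∣.∣m⇒∣-m n∣x-y))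
  where
  negate : ∀ x y → ℤ.- (x - y) ≡ y - x
  negate = solve-∀

≈-trans : ∀ {x y z n} → x ≈ y mod n → y ≈ z mod n → x ≈ z mod n
≈-trans {x} {y} {z} (≈-by n∣x-y) (≈-by n∣y-z) =
  ≈-by (subst (_ ∣ℤ_) (telescope x y z) (ℤ∣.∣m∣n⇒∣m+n n∣x-y n∣y-z))
  where
  telescope : ∀ x y z → (x - y) + (y - z) ≡ x - z
  telescope = solve-∀

≈-+ : ∀ {x x′ y y′ n} → x ≈ x′ mod n → y ≈ y′ mod n → x + y ≈ x′ + y′ mod n
≈-+ {x} {x′} {y} {y′} (≈-by n∣x-x′) (≈-by n∣y-y′) =
  ≈-by (subst (_ ∣ℤ_) (regroup x x′ y y′) (ℤ∣.∣m∣n⇒∣m+n n∣x-x′ n∣y-y′))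
  where
  regroup : ∀ x x′ y y′ → (x - x′) + (y - y′) ≡ (x + y) - (x′ + y′)
  regroup = solve-∀

≈-*ˡ : ∀ c {x y n} → x ≈ y mod n → c * x ≈ c * y mod n
≈-*ˡ c {x} {y} (≈-by n∣x-y) = ≈-by (subst (_ ∣ℤ_) (distrib c x y) (ℤ∣.∣n⇒∣m*n c n∣x-y))
  where
  distrib : ∀ c x y → c * (x - y) ≡ c * x - c * y
  distrib = solve-∀

≈-scale : ∀ c {x y n} → x ≈ y mod n → c * x ≈ c * y mod (n * c)
≈-scale c {x} {y} (≈-by n∣x-y) = ≈-by (subst (_ ∣ℤ_) (distrib c x y) (ℤ∣.*-monoˡ-∣ c n∣x-y))
  where
  distrib : ∀ c x y → (x - y) * c ≡ c * x - c * y
  distrib = solve-∀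

≈-weaken : ∀ {d n x y} → d ∣ℤ n → x ≈ y mod n → x ≈ y mod d
≈-weaken d∣n (≈-by n∣x-y) = ≈-by (ℤ∣.∣-trans d∣n n∣x-y)

≈-+-multiple : ∀ x n c → x + n * c ≈ x mod n
≈-+-multiple x n c = ≈-by (divides c (cancel x n c))
  where
  cancel : ∀ x n c → (x + n * c) - x ≡ c * n
  cancel = solve-∀

∣-resp-≈ : ∀ {x y n} → x ≈ y mod n → n ∣ℤ y → n ∣ℤ x
∣-resp-≈ {x} {y} (≈-by n∣x-y) n∣y = subst (_ ∣ℤ_) (restore x y) (ℤ∣.∣m∣n⇒∣m+n n∣x-y n∣y)
  where
  restore : ∀ x y → (x - y) + y ≡ x
  restore = solve-∀

≈-residue : ∀ x d .{{_ : ℕ.NonZero d}} → x ≈ + (x %ℕ d) mod + d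
≈-residue x d = ≈-by (divides (x /ℕ d) (move (a≡a%ℕn+[a/ℕn]*n x d)))
  where
  move : ∀ {x r q} → x ≡ r + q → x - r ≡ q
  move {r = r} {q} refl = cancel r q
    where
    cancel : ∀ r q → (r + q) - r ≡ q
    cancel = solve-∀

prime-5 : Prime 5
prime-5 = from-yes (prime? 5)

5∤ : ∀ n {_ : False (5 ℕ∣.∣? n)} → ¬ (5 ∣ n)
5∤ n {5∤n} = toWitnessFalse 5∤n

5∤3^ : ∀ j → ¬ (5 ∣ 3 ^ j)
5∤3^ zero = 5∤ 1
5∤3^ (suc j) 5∣3^[1+j] with euclidsLemma 3 (3 ^ j) prime-5 5∣3^[1+j]
... | inj₁ 5∣3 = 5∤ 3 5∣3
... | inj₂ 5∣3^j = 5∤3^ j 5∣3^j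

prime-∣-product : ∀ {p} → Prime p → ∀ x y → + p ∣ℤ x * y → + p ∣ℤ x ⊎ + p ∣ℤ y
prime-∣-product {p} prime-p x y p∣xy
  with euclidsLemma ℤ.∣ x ∣ ℤ.∣ y ∣ prime-p (subst (p ∣_) (ℤ.abs-* x y) (ℤ∣.∣⇒∣ᵤ p∣xy))
... | inj₁ p∣x = inj₁ (ℤ∣.∣ᵤ⇒∣ p∣x)
... | inj₂ p∣y = inj₂ (ℤ∣.∣ᵤ⇒∣ p∣y)

coprime-common-divisor : ∀ {d m x} → gcd (+ m) x ≡ + 1 → d ∣ m → + d ∣ℤ x → d ≡ 1
coprime-common-divisor {d} {m} {x} gcd≡1 d∣m d∣x =
  ℕ∣.∣1⇒≡1 (subst (ℤ∣ᵤ._∣_ (+ d)) gcd≡1 (gcd-greatest {+ m} {x} {+ d} d∣m (ℤ∣.∣⇒∣ᵤ d∣x)))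

-- Fermat's little theorem for 5, in the form 5 ∣ 1 + 4r⁴ for every unit r.
fermat-5 : ∀ r → r < 5 → r ≢ 0 → 5 ∣ 1 ℕ.+ 4 ℕ.* (r ℕ.* r ℕ.* r ℕ.* r)
fermat-5 0 _ r≢0 = ⊥-elim (r≢0 refl)
fermat-5 1 _ _ = ℕ∣.divides 1 refl
fermat-5 2 _ _ = ℕ∣.divides 13 refl
fermat-5 3 _ _ = ℕ∣.divides 65 refl
fermat-5 4 _ _ = ℕ∣.divides 205 refl
fermat-5 (suc (suc (suc (suc (suc _))))) (s≤s (s≤s (s≤s (s≤s (s≤s ()))))) _

cancel-mod-5 : ∀ q u → ¬ (+ 5 ∣ℤ u) → ∃ λ k → + 5 ∣ℤ q + + k * u
cancel-mod-5 q u 5∤u = k , ∣-resp-≈ (≈-+ (≈-residue q 5) (≈-*ˡ (+ k) (≈-residue u 5))) 5∣s+kr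
  where
  r s k : ℕ
  r = u %ℕ 5
  s = q %ℕ 5
  k = s ℕ.* (4 ℕ.* (r ℕ.* r ℕ.* r))

  r≢0 : r ≢ 0
  r≢0 r≡0 = 5∤u (∣-resp-≈ (≈-residue u 5) (subst (λ r → + 5 ∣ℤ + r) (sym r≡0) (divides (+ 0) refl)))

  factor : ∀ s r → s ℕ.+ s ℕ.* (4 ℕ.* (r ℕ.* r ℕ.* r)) ℕ.* r ≡ s ℕ.* (1 ℕ.+ 4 ℕ.* (r ℕ.* r ℕ.* r ℕ.* r))
  factor = ℕ-Ring.solve-∀

  5∣s+kr : + 5 ∣ℤ + s + + k * + r
  5∣s+kr = subst (+ 5 ∣ℤ_) (trans (ℤ.pos-+ s (k ℕ.* r)) (cong (_+_ (+ s)) (ℤ.pos-* k r)))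
    (ℤ∣.∣ᵤ⇒∣ (subst (5 ∣_) (sym (factor s r)) (ℕ∣.∣n⇒∣m*n s (fermat-5 r (n%ℕd<d u 5) r≢0))))

-- The ring ℤ[φ], φ² = φ + 1.  The pair (y , x) stands for y + xφ.  The operations are
-- defined over an arbitrary carrier so that identities in ℤ[φ] can be verified by the
-- ring solver on the symbolic instance (carrier: polynomials over ℤ).

module ℤ[φ]-Operations {A : Set} (_⊕_ _⊗_ : A → A → A) (ι : ℤ → A) where

  infixl 6 _+ᵩ_
  infixl 7 _·_ _•_
  infixr 8 _^ᵩ_

  _·_ : A × A → A × A → A × A
  (y , x) · (y′ , x′) = ((y ⊗ y′) ⊕ (x ⊗ x′) , ((y ⊗ x′) ⊕ (x ⊗ y′)) ⊕ (x ⊗ x′))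

  _+ᵩ_ : A × A → A × A → A × A
  (y , x) +ᵩ (y′ , x′) = (y ⊕ y′ , x ⊕ x′)

  _•_ : A → A × A → A × A
  c • (y , x) = (c ⊗ y , c ⊗ x)

  1ᵩ φ : A × A
  1ᵩ = (ι (+ 1) , ι (+ 0))
  φ = (ι (+ 0) , ι (+ 1))

  _^ᵩ_ : A × A → ℕ → A × A
  p ^ᵩ zero = 1ᵩ
  p ^ᵩ suc k = p · p ^ᵩ k

  1+_·_ : A → A × A → A × A
  1+ t · (α , β) = (ι (+ 1) ⊕ (t ⊗ α) , t ⊗ β)

  -- Binomial expansions used to lift periods:
  --   (1 + 5v·X)⁵  = 1 + 25v·(X + 5·(2vX² + 10v²X³ + 25v³X⁴ + 25v⁴X⁵))
  --   (1 + 15v·X)³ = 1 + 45v·(X + 5·(3vX² + 15v²X³))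
  five-correction three-correction : A → A × A → A × A
  five-correction v X =
    (ι (+ 2) ⊗ v) • X ^ᵩ 2 +ᵩ ((ι (+ 10) ⊗ v) ⊗ v) • X ^ᵩ 3
      +ᵩ (((ι (+ 25) ⊗ v) ⊗ v) ⊗ v) • X ^ᵩ 4 +ᵩ ((((ι (+ 25) ⊗ v) ⊗ v) ⊗ v) ⊗ v) • X ^ᵩ 5
  three-correction v X = (ι (+ 3) ⊗ v) • X ^ᵩ 2 +ᵩ ((ι (+ 15) ⊗ v) ⊗ v) • X ^ᵩ 3

  fifth-power fifth-power-expanded cube cube-expanded : A → A × A → A × A
  fifth-power v X = (1+ (v ⊗ ι (+ 5)) · X) ^ᵩ 5
  fifth-power-expanded v X =
    1+ (ι (+ 5) ⊗ (v ⊗ ι (+ 5))) · (X +ᵩ ι (+ 5) • five-correction v X)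
  cube v X = (1+ (v ⊗ ι (+ 15)) · X) ^ᵩ 3
  cube-expanded v X = 1+ (ι (+ 3) ⊗ (v ⊗ ι (+ 15))) · (X +ᵩ ι (+ 5) • three-correction v X)

ℤ[φ] : Set
ℤ[φ] = ℤ × ℤ

open ℤ[φ]-Operations _+_ _*_ (λ n → n) public
private
  module Symbolic {n} = ℤ[φ]-Operations {Polynomial n} _:+_ _:*_ con

·-identityˡ : ∀ p → 1ᵩ · p ≡ p
·-identityˡ (y , x) = cong₂ _,_
  (solve 2 (λ y x → proj₁ (Symbolic.1ᵩ Symbolic.· (y , x)) := y) refl y x)
  (solve 2 (λ y x → proj₂ (Symbolic.1ᵩ Symbolic.· (y , x)) := x) refl y x)

·-assoc : ∀ p q r → (p · q) · r ≡ p · (q · r)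
·-assoc (a , b) (c , d) (e , f) = cong₂ _,_
  (solve 6 (λ a b c d e f → proj₁ (((a , b) Symbolic.· (c , d)) Symbolic.· (e , f))
                         := proj₁ ((a , b) Symbolic.· ((c , d) Symbolic.· (e , f)))) refl a b c d e f)
  (solve 6 (λ a b c d e f → proj₂ (((a , b) Symbolic.· (c , d)) Symbolic.· (e , f))
                         := proj₂ ((a , b) Symbolic.· ((c , d) Symbolic.· (e , f)))) refl a b c d e f)

^ᵩ-+ : ∀ p m n → p ^ᵩ (m ℕ.+ n) ≡ p ^ᵩ m · p ^ᵩ n
^ᵩ-+ p zero n = sym (·-identityˡ (p ^ᵩ n))
^ᵩ-+ p (suc m) n = trans (cong (p ·_) (^ᵩ-+ p m n)) (sym (·-assoc p (p ^ᵩ m) (p ^ᵩ n)))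

^ᵩ-* : ∀ p k n → p ^ᵩ (k ℕ.* n) ≡ (p ^ᵩ n) ^ᵩ k
^ᵩ-* p zero n = refl
^ᵩ-* p (suc k) n = trans (^ᵩ-+ p n (k ℕ.* n)) (cong (p ^ᵩ n ·_) (^ᵩ-* p k n))

fifth-power-expansion : ∀ v X → fifth-power v X ≡ fifth-power-expanded v X
fifth-power-expansion v (α , β) = cong₂ _,_
  (solve 3 (λ v α β → proj₁ (Symbolic.fifth-power v (α , β))
                   := proj₁ (Symbolic.fifth-power-expanded v (α , β))) refl v α β)
  (solve 3 (λ v α β → proj₂ (Symbolic.fifth-power v (α , β))
                   := proj₂ (Symbolic.fifth-power-expanded v (α , β))) refl v α β)

cube-expansion : ∀ v X → cube v X ≡ cube-expanded v X
cube-expansion v (α , β) = cong₂ _,_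
  (solve 3 (λ v α β → proj₁ (Symbolic.cube v (α , β)) := proj₁ (Symbolic.cube-expanded v (α , β))) refl v α β)
  (solve 3 (λ v α β → proj₂ (Symbolic.cube v (α , β)) := proj₂ (Symbolic.cube-expanded v (α , β))) refl v α β)

-- X = α + βφ is exactly divisible by √5: X ≡ β(φ − 3) (mod 5) with 5 ∤ β.
-- (Modulo 5, φ ≡ 3 is a double root of x² − x − 1, and φ − 3 is an associate of √5.)
Exact√5 : ℤ[φ] → Set
Exact√5 (α , β) = + 5 ∣ℤ α + + 3 * β × ¬ (+ 5 ∣ℤ β)

exact√5? : ∀ X → Dec (Exact√5 X)
exact√5? (α , β) = (+ 5 ∣ℤ? α + + 3 * β) ×-dec ¬? (+ 5 ∣ℤ? β)

exact√5-+5 : ∀ X Y → Exact√5 X → Exact√5 (X +ᵩ + 5 • Y)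
exact√5-+5 (α , β) (γ , δ) (5∣α+3β , 5∤β) = 5∣α′+3β′ , 5∤β′
  where
  regroup : ∀ α β γ δ → (α + + 3 * β) + (γ + + 3 * δ) * + 5 ≡ (α + + 5 * γ) + + 3 * (β + + 5 * δ)
  regroup = solve-∀
  5∣α′+3β′ : + 5 ∣ℤ (α + + 5 * γ) + + 3 * (β + + 5 * δ)
  5∣α′+3β′ = subst (+ 5 ∣ℤ_) (regroup α β γ δ) (ℤ∣.∣m∣n⇒∣m+n 5∣α+3β (ℤ∣.∣n⇒∣m*n (γ + + 3 * δ) ℤ∣.∣-refl))
  5∤β′ : ¬ (+ 5 ∣ℤ β + + 5 * δ)
  5∤β′ 5∣β′ = 5∤β (ℤ∣.∣m+n∣n⇒∣m 5∣β′ (ℤ∣.∣m⇒∣m*n δ ℤ∣.∣-refl))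

OnePlusExact : ℤ → ℤ[φ] → Set
OnePlusExact t p = Σ ℤ[φ] λ X → p ≡ 1+ t · X × Exact√5 X

ExactPeriod : ℕ → ℕ → Set
ExactPeriod t P = OnePlusExact (+ t) (φ ^ᵩ P)

one-plus-exact? : ∀ t p → Maybe (OnePlusExact t p)
one-plus-exact? t (y , x) with t ∣ℤ? y - + 1 | t ∣ℤ? x
... | yes (divides α y-1≡αt) | yes (divides β x≡βt) with exact√5? (α , β)
...   | yes exact = just ((α , β) , cong₂ _,_ (unshift y-1≡αt) (trans x≡βt (ℤ.*-comm β t)) , exact)
  where
  unshift : ∀ {y α} → y - + 1 ≡ α * t → y ≡ + 1 + t * α
  unshift {y} {α} y-1≡αt = trans (restore y) (cong (_+_ (+ 1)) (trans y-1≡αt (ℤ.*-comm α t)))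
    where
    restore : ∀ y → y ≡ + 1 + (y - + 1)
    restore = solve-∀
...   | no _ = nothing
one-plus-exact? t (y , x) | _ | _ = nothing

period-5 : ExactPeriod 5 20
period-5 = from-just (one-plus-exact? (+ 5) (φ ^ᵩ 20))

period-10 : ExactPeriod 10 60
period-10 = from-just (one-plus-exact? (+ 10) (φ ^ᵩ 60))

period-20 : ExactPeriod 20 60
period-20 = from-just (one-plus-exact? (+ 20) (φ ^ᵩ 60))

period-15 : ExactPeriod 15 40
period-15 = from-just (one-plus-exact? (+ 15) (φ ^ᵩ 40))

period-30 : ExactPeriod 30 120
period-30 = from-just (one-plus-exact? (+ 30) (φ ^ᵩ 120))

period-35 : ExactPeriod 35 80
period-35 = from-just (one-plus-exact? (+ 35) (φ ^ᵩ 80))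

period-70 : ExactPeriod 70 240
period-70 = from-just (one-plus-exact? (+ 70) (φ ^ᵩ 240))

lift-5 : ∀ {t P} → 5 ∣ t → ExactPeriod t P → ExactPeriod (5 ℕ.* t) (5 ℕ.* P)
lift-5 {P = P} (ℕ∣.divides v refl) (X , φᴾ≡1+tX , exact) =
  X′ , φ⁵ᴾ≡ , exact√5-+5 X _ exact
  where
  open ≡-Reasoning
  X′ : ℤ[φ]
  X′ = X +ᵩ + 5 • five-correction (+ v) X
  φ⁵ᴾ≡ : φ ^ᵩ (5 ℕ.* P) ≡ 1+ + (5 ℕ.* (v ℕ.* 5)) · X′
  φ⁵ᴾ≡ = begin
    φ ^ᵩ (5 ℕ.* P)                   ≡⟨ ^ᵩ-* φ 5 P ⟩
    (φ ^ᵩ P) ^ᵩ 5                    ≡⟨ cong (_^ᵩ 5) φᴾ≡1+tX ⟩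
    (1+ + (v ℕ.* 5) · X) ^ᵩ 5        ≡⟨ cong (λ t → (1+ t · X) ^ᵩ 5) (ℤ.pos-* v 5) ⟩
    fifth-power (+ v) X             ≡⟨ fifth-power-expansion (+ v) X ⟩
    fifth-power-expanded (+ v) X    ≡⟨ cong (λ t → 1+ t · X′) (sym (trans (ℤ.pos-* 5 (v ℕ.* 5)) (cong (_*_ (+ 5)) (ℤ.pos-* v 5)))) ⟩
    1+ + (5 ℕ.* (v ℕ.* 5)) · X′ ∎

lift-3 : ∀ {t P} → 15 ∣ t → ExactPeriod t P → ExactPeriod (3 ℕ.* t) (3 ℕ.* P)
lift-3 {P = P} (ℕ∣.divides v refl) (X , φᴾ≡1+tX , exact) =
  X′ , φ³ᴾ≡ , exact√5-+5 X _ exact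
  where
  open ≡-Reasoning
  X′ : ℤ[φ]
  X′ = X +ᵩ + 5 • three-correction (+ v) X
  φ³ᴾ≡ : φ ^ᵩ (3 ℕ.* P) ≡ 1+ + (3 ℕ.* (v ℕ.* 15)) · X′
  φ³ᴾ≡ = begin
    φ ^ᵩ (3 ℕ.* P)                   ≡⟨ ^ᵩ-* φ 3 P ⟩
    (φ ^ᵩ P) ^ᵩ 3                    ≡⟨ cong (_^ᵩ 3) φᴾ≡1+tX ⟩
    (1+ + (v ℕ.* 15) · X) ^ᵩ 3       ≡⟨ cong (λ t → (1+ t · X) ^ᵩ 3) (ℤ.pos-* v 15) ⟩
    cube (+ v) X                    ≡⟨ cube-expansion (+ v) X ⟩
    cube-expanded (+ v) X           ≡⟨ cong (λ t → 1+ t · X′) (sym (trans (ℤ.pos-* 3 (v ℕ.* 15)) (cong (_*_ (+ 3)) (ℤ.pos-* v 15)))) ⟩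
    1+ + (3 ℕ.* (v ℕ.* 15)) · X′ ∎

periods-c·5^ : ∀ c {P} → ExactPeriod (c ℕ.* 5) P → ∀ i → ∃ (ExactPeriod (c ℕ.* 5 ^ suc i))
periods-c·5^ c {P} base zero = P , base
periods-c·5^ c base (suc i) with periods-c·5^ c base i
... | P , period = 5 ℕ.* P , subst (λ t → ExactPeriod t (5 ℕ.* P)) (rearrange c (5 ^ i)) (lift-5 5∣t period)
  where
  rearrange : ∀ c x → 5 ℕ.* (c ℕ.* (5 ℕ.* x)) ≡ c ℕ.* (5 ℕ.* (5 ℕ.* x))
  rearrange = ℕ-Ring.solve-∀
  5∣t : 5 ∣ c ℕ.* (5 ℕ.* 5 ^ i)
  5∣t = ℕ∣.∣n⇒∣m*n c (ℕ∣.∣m⇒∣m*n (5 ^ i) (ℕ∣.∣-refl {5}))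

periods-3^ : ∀ i → ∃ (ExactPeriod (3 ^ suc i ℕ.* 5))
periods-3^ zero = 40 , period-15
periods-3^ (suc i) with periods-3^ i
... | P , period = 3 ℕ.* P , subst (λ t → ExactPeriod t (3 ℕ.* P)) (rearrange (3 ^ i)) (lift-3 15∣t period)
  where
  rearrange : ∀ x → 3 ℕ.* (3 ℕ.* x ℕ.* 5) ≡ 3 ℕ.* (3 ℕ.* x) ℕ.* 5
  rearrange = ℕ-Ring.solve-∀
  15∣t : 15 ∣ 3 ℕ.* 3 ^ i ℕ.* 5
  15∣t = ℕ∣.divides (3 ^ i) (rearrange′ (3 ^ i))
    where
    rearrange′ : ∀ x → 3 ℕ.* x ℕ.* 5 ≡ x ℕ.* 15
    rearrange′ = ℕ-Ring.solve-∀

record Splitting (m : ℕ) : Set where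
  constructor splitting
  field
    c k : ℕ
    m≡c·5ᵏ : m ≡ c ℕ.* 5 ^ k
    5∤c : ¬ (5 ∣ c)
    base-period : ∃ (ExactPeriod (c ℕ.* 5))

split-F : ∀ {m} → InF m → Splitting m
split-F (k , inj₁ m≡5ᵏ) =
  splitting 1 k (trans m≡5ᵏ (sym (ℕ.*-identityˡ (5 ^ k)))) (5∤ 1) (20 , period-5)
split-F (k , inj₂ (inj₁ m≡)) = splitting 2 k m≡ (5∤ 2) (60 , period-10)
split-F (k , inj₂ (inj₂ (inj₁ m≡))) = splitting 4 k m≡ (5∤ 4) (60 , period-20)
split-F (k , inj₂ (inj₂ (inj₂ (inj₁ (zero , () , _)))))
split-F (k , inj₂ (inj₂ (inj₂ (inj₁ (suc i , _ , m≡))))) =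
  splitting (3 ^ suc i) k m≡ (5∤3^ (suc i)) (periods-3^ i)
split-F (k , inj₂ (inj₂ (inj₂ (inj₂ (inj₁ m≡))))) = splitting 6 k m≡ (5∤ 6) (120 , period-30)
split-F (k , inj₂ (inj₂ (inj₂ (inj₂ (inj₂ (inj₁ m≡)))))) = splitting 7 k m≡ (5∤ 7) (80 , period-35)
split-F (k , inj₂ (inj₂ (inj₂ (inj₂ (inj₂ (inj₂ m≡)))))) = splitting 14 k m≡ (5∤ 14) (240 , period-70)

exact-period : ∀ {m} → InF m → 5 ∣ m → ∃ (ExactPeriod m)
exact-period {m} m∈F 5∣m with split-F m∈F
... | splitting c zero m≡c·1 5∤c _ = ⊥-elim (5∤c (subst (5 ∣_) (trans m≡c·1 (ℕ.*-identityʳ c)) 5∣m))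
... | splitting c (suc i) m≡c·5ᵏ _ (_ , base) =
  subst (∃ ∘ ExactPeriod) (sym m≡c·5ᵏ) (periods-c·5^ c base i)

discriminant-mod-5 : ∀ a b → b * b - a * b - a * a ≈ (b - + 3 * a) * (b - + 3 * a) mod + 5
discriminant-mod-5 a b = ≈-by (divides (a * b - + 2 * a * a) (complete-square a b))
  where
  complete-square : ∀ a b →
    (b * b - a * b - a * a) - (b - + 3 * a) * (b - + 3 * a) ≡ (a * b - + 2 * a * a) * + 5
  complete-square = solve-∀

module _ (a b : ℤ) where

  private
    W : ℕ → ℤ
    W = w a b

  infix 5 _◃_
  _◃_ : ℤ[φ] → ℕ → ℤ
  (y , x) ◃ n = y * W n + x * W (suc n)

  ◃-suc : ∀ p n → p ◃ suc n ≡ φ · p ◃ n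
  ◃-suc (y , x) n = shift y x (W n) (W (suc n))
    where
    shift : ∀ y x w₀ w₁ →
      y * w₁ + x * (w₁ + w₀) ≡ (+ 0 * y + + 1 * x) * w₀ + ((+ 0 * x + + 1 * y) + + 1 * x) * w₁
    shift = solve-∀

  w-shift : ∀ P n → W (P ℕ.+ n) ≡ φ ^ᵩ P ◃ n
  w-shift zero n = unit (W n) (W (suc n))
    where
    unit : ∀ w₀ w₁ → w₀ ≡ + 1 * w₀ + + 0 * w₁
    unit = solve-∀
  w-shift (suc P) n = begin
    W (suc P ℕ.+ n)       ≡⟨ cong W (sym (ℕ.+-suc P n)) ⟩
    W (P ℕ.+ suc n)       ≡⟨ w-shift P (suc n) ⟩
    φ ^ᵩ P ◃ suc n        ≡⟨ ◃-suc (φ ^ᵩ P) n ⟩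
    φ ^ᵩ suc P ◃ n        ∎
    where open ≡-Reasoning

  ◃-1+ : ∀ t X n → (1+ t · X) ◃ n ≡ W n + t * (X ◃ n)
  ◃-1+ t (α , β) n = expand t α β (W n) (W (suc n))
    where
    expand : ∀ t α β w₀ w₁ → (+ 1 + t * α) * w₀ + t * β * w₁ ≡ w₀ + t * (α * w₀ + β * w₁)
    expand = solve-∀

  ◃-cong : ∀ X {i j d} → W i ≈ W j mod d → W (suc i) ≈ W (suc j) mod d → X ◃ i ≈ X ◃ j mod d
  ◃-cong (α , β) wᵢ≈wⱼ wᵢ₊₁≈wⱼ₊₁ = ≈-+ (≈-*ˡ α wᵢ≈wⱼ) (≈-*ˡ β wᵢ₊₁≈wⱼ₊₁)

  ◃-suc-mod-5 : ∀ {X} → Exact√5 X → ∀ n → X ◃ suc n ≈ + 3 * (X ◃ n) mod + 5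
  ◃-suc-mod-5 {α , β} (5∣α+3β , _) n =
    ≈-by (subst (+ 5 ∣ℤ_) (reduce α β (W n) (W (suc n)))
      (ℤ∣.∣m∣n⇒∣m+n (ℤ∣.∣m⇒∣m*n (W (suc n) - + 3 * W n) 5∣α+3β) (ℤ∣.∣n⇒∣m*n (+ 2 * β * W n - β * W (suc n)) ℤ∣.∣-refl)))
    where
    reduce : ∀ α β w₀ w₁ → (α + + 3 * β) * (w₁ - + 3 * w₀) + (+ 2 * β * w₀ - β * w₁) * + 5
                           ≡ (α * w₁ + β * (w₁ + w₀)) - + 3 * (α * w₀ + β * w₁)
    reduce = solve-∀

  ◃-unit : ∀ {X} → Exact√5 X → ¬ (+ 5 ∣ℤ b * b - a * b - a * a) → ∀ n → ¬ (+ 5 ∣ℤ X ◃ n)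
  ◃-unit {α , β} (5∣α+3β , 5∤β) 5∤disc zero 5∣u₀ =
    [ 5∤β , 5∤b-3a ]′ (prime-∣-product prime-5 β (b - + 3 * a) (∣-resp-≈ u₀-mod-5 5∣u₀))
    where
    reduce : ∀ α β a b → β * (b - + 3 * a) - (α * a + β * b) ≡ ℤ.- ((α + + 3 * β) * a)
    reduce = solve-∀
    u₀-mod-5 : β * (b - + 3 * a) ≈ α * a + β * b mod + 5
    u₀-mod-5 = ≈-by (subst (+ 5 ∣ℤ_) (sym (reduce α β a b)) (ℤ∣.∣m⇒∣-m (ℤ∣.∣m⇒∣m*n a 5∣α+3β)))
    5∤b-3a : ¬ (+ 5 ∣ℤ b - + 3 * a)
    5∤b-3a 5∣b-3a = 5∤disc (∣-resp-≈ (discriminant-mod-5 a b) (ℤ∣.∣m⇒∣m*n (b - + 3 * a) 5∣b-3a))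
  ◃-unit {X} exact 5∤disc (suc n) 5∣uₙ₊₁ =
    [ 5∤3 , ◃-unit {X} exact 5∤disc n ]′
      (prime-∣-product prime-5 (+ 3) (X ◃ n) (∣-resp-≈ (≈-sym (◃-suc-mod-5 {X} exact n)) 5∣uₙ₊₁))
    where
    5∤3 : ¬ (+ 5 ∣ℤ + 3)
    5∤3 = 5∤ 3 ∘ ℤ∣.∣⇒∣ᵤ

  module Period {M : ℤ} {P : ℕ} {X : ℤ[φ]} (φᴾ≡1+MX : φ ^ᵩ P ≡ 1+ M · X) where

    advance : ∀ j → W (P ℕ.+ j) ≡ W j + M * (X ◃ j)
    advance j = trans (w-shift P j) (trans (cong (_◃ j) φᴾ≡1+MX) (◃-1+ M X j))

    advance-k : ∀ k n → W (suc k ℕ.* P ℕ.+ n) ≡ W (k ℕ.* P ℕ.+ n) + M * (X ◃ k ℕ.* P ℕ.+ n)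
    advance-k k n = trans (cong W (ℕ.+-assoc P (k ℕ.* P) n)) (advance (k ℕ.* P ℕ.+ n))

    periodic : ∀ k n → W (k ℕ.* P ℕ.+ n) ≈ W n mod M
    periodic zero n = ≡⇒≈ refl
    periodic (suc k) n =
      ≈-trans (≡⇒≈ (advance-k k n)) (≈-trans (≈-+-multiple _ M _) (periodic k n))

    iterate : + 5 ∣ℤ M → ∀ k n → W (k ℕ.* P ℕ.+ n) ≈ W n + + k * (M * (X ◃ n)) mod (+ 5 * M)
    iterate 5∣M zero n = ≡⇒≈ (no-increment (W n) (M * (X ◃ n)))
      where
      no-increment : ∀ w d → w ≡ w + + 0 * d
      no-increment = solve-∀
    iterate 5∣M (suc k) n =
      ≈-trans (≡⇒≈ (advance-k k n))
        (≈-trans (≈-+ (iterate 5∣M k n) (≈-scale M Xⱼ≈Xₙ)) (≡⇒≈ (regroup k)))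
      where
      periodic-5 : ∀ i → W (k ℕ.* P ℕ.+ i) ≈ W i mod + 5
      periodic-5 i = ≈-weaken 5∣M (periodic k i)
      Xⱼ≈Xₙ : X ◃ k ℕ.* P ℕ.+ n ≈ X ◃ n mod + 5
      Xⱼ≈Xₙ = ◃-cong X {k ℕ.* P ℕ.+ n} {n} (periodic-5 n)
        (subst (λ i → W i ≈ W (suc n) mod + 5) (ℕ.+-suc (k ℕ.* P) n) (periodic-5 (suc n)))
      collect : ∀ w k d → (w + k * d) + d ≡ w + (+ 1 + k) * d
      collect = solve-∀
      regroup : ∀ k → (W n + + k * (M * (X ◃ n))) + M * (X ◃ n) ≡ W n + + suc k * (M * (X ◃ n))
      regroup k = trans (collect (W n) (+ k) (M * (X ◃ n)))
        (cong (λ c → W n + c * (M * (X ◃ n))) (sym (ℤ.pos-+ 1 k)))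

  complete-5m : ∀ {m P X} → φ ^ᵩ P ≡ 1+ + m · X → Exact√5 X → 5 ∣ m →
    ¬ (+ 5 ∣ℤ b * b - a * b - a * a) → ResidueComplete a b m → ResidueComplete a b (5 ℕ.* m)
  complete-5m {m} {P} {X} φᴾ≡1+mX exact 5∣m 5∤disc complete x with complete x
  ... | n₀ , m∣wₙ₀-x with ℤ∣.∣ᵤ⇒∣ {+ m} {W n₀ - x} m∣wₙ₀-x
  ... | divides q wₙ₀-x≡qm =
    k ℕ.* P ℕ.+ n₀ , ℤ∣.∣⇒∣ᵤ {+ (5 ℕ.* m)} {W (k ℕ.* P ℕ.+ n₀) - x}
                       (subst (_∣ℤ W (k ℕ.* P ℕ.+ n₀) - x) (sym (ℤ.pos-* 5 m)) (difference wₙ≈x))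
    where
    open Period {+ m} {P} {X} φᴾ≡1+mX
    u : ℤ
    u = X ◃ n₀
    cancellation : ∃ λ k → + 5 ∣ℤ q + + k * u
    cancellation = cancel-mod-5 q u (◃-unit {X} exact 5∤disc n₀)
    k : ℕ
    k = proj₁ cancellation
    distribute : ∀ q k u M → (q + k * u) * M ≡ q * M + k * (M * u)
    distribute = solve-∀
    regroup : ∀ w x c → (w - x) + c ≡ (w + c) - x
    regroup = solve-∀
    hit : W n₀ + + k * (+ m * u) ≈ x mod (+ 5 * + m)
    hit = ≈-by (subst (+ 5 * + m ∣ℤ_) eq (ℤ∣.*-monoˡ-∣ (+ m) (proj₂ cancellation)))
      where
      open ≡-Reasoning
      eq : (q + + k * u) * + m ≡ (W n₀ + + k * (+ m * u)) - x
      eq = begin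
        (q + + k * u) * + m               ≡⟨ distribute q (+ k) u (+ m) ⟩
        q * + m + + k * (+ m * u)         ≡⟨ cong (_+ + k * (+ m * u)) (sym wₙ₀-x≡qm) ⟩
        (W n₀ - x) + + k * (+ m * u)      ≡⟨ regroup (W n₀) x (+ k * (+ m * u)) ⟩
        (W n₀ + + k * (+ m * u)) - x      ∎
    wₙ≈x : W (k ℕ.* P ℕ.+ n₀) ≈ x mod (+ 5 * + m)
    wₙ≈x = ≈-trans (iterate (ℤ∣.∣ᵤ⇒∣ 5∣m) k n₀) hit

lemma2p3 : (a b : ℤ) (m : ℕ) → ℕ.NonZero m → InF m → 5 ∣ m →
    gcd (ℤ.+ m) (b * b - a * b - a * a) ≡ ℤ.+ 1 →
    ResidueComplete a b m → ResidueComplete a b (5 ℕ.* m)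
lemma2p3 a b m _ m∈F 5∣m gcd≡1 complete with exact-period m∈F 5∣m
... | P , X , φᴾ≡1+mX , exact = complete-5m a b {m} {P} {X} φᴾ≡1+mX exact 5∣m 5∤disc complete
  where
  5∤disc : ¬ (+ 5 ∣ℤ b * b - a * b - a * a)
  5∤disc 5∣disc with coprime-common-divisor gcd≡1 5∣m 5∣disc
  ... | ()
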